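{- Let $t,u$ be terms, $k\in\mathbb{N}$, and $\vec{x}=(x_1,\dots,x_k)$ a list of pairwise distinct variables containing all free variables of $t$ and of $u$. If $t\simeq_{\mathsf{sh}}u$ then $[\![t]\!]_{\vec{x}}=[\![u]\!]_{\vec{x}}$.
   Context: Terms: $t ::= x \mid \lambda x.t \mid tu$ up to $\alpha$-conversion; values are variables and abstractions. Contexts $C ::= [\cdot]\mid\lambda x.C\mid Ct\mid tC$. Root rules: $(\lambda x.t)v \mapsto_{\beta_v} t\{v/x\}$ ($v$ value); $(\lambda x.t)us \mapsto_{\sigma_1} (\lambda x.ts)u$ if $x\notin\mathrm{fv}(s)$; $v((\lambda x.s)u) \mapsto_{\sigma_3} (\lambda x.vs)u$ if $v$ value and $x\notin\mathrm{fv}(v)$. $\to_{\mathsf{sh}}$ is the closure of the union of these rules under all contexts, and $\simeq_{\mathsf{sh}}$ its reflexive, symmetric, transitive closure. Types: negative $N ::= P\multimap Q$; positive $P,Q ::= [N_1,\dots,N_n]$ finite multisets ($n\ge0$), $\mathbf{0}$ the empty multiset. Environments: maps from variables to positive types, $\mathbf{0}$ almost everywhere; $\uplus$ pointwise multiset sum. Rules: (ax) $x\colon P\vdash x\colon P$; (@) from $\Gamma\vdash t\colon[P\multimap Q]$ and $\Gamma'\vdash u\colon P$ infer $\Gamma\uplus\Gamma'\vdash tu\colon Q$; ($\lambda$) for $n\ge0$, from $\Gamma_i,x\colon P_i\vdash t\colon Q_i$ ($1\le i\le n$) infer $\biguplus_i\Gamma_i\vdash\lambda x.t\colon[P_1\multimap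 Q_1,\dots,P_n\multimap Q_n]$. Semantics: $[\![t]\!]_{\vec{x}} = \{((P_1,\dots,P_k),Q) \mid \text{there is a derivation of } x_1\colon P_1,\dots,x_k\colon P_k \vdash t \colon Q\}$. -}

module Defs where

open import Data.Nat using (ℕ; zero; suc)
open import Data.Fin using (Fin; zero; suc)
open import Data.List using (List; []; _∷_; _++_)
open import Data.Vec using (Vec; []; _∷_; zipWith; replicate; _[_]≔_)
open import Data.Vec.Relation.Binary.Pointwise.Inductive using (Pointwise)
open import Data.Product using (_×_; _,_; ∃-syntax)
open import Relation.Unary using (Pred)
open import Relation.Binary.Construct.Closure.Equivalence using (EqClosure)
open import Level using (0ℓ)

-- Terms, up to α-conversion: well-scoped de Bruijn terms.
-- Tm k = terms whose free variables are among x₁,…,x_k, where the free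
-- variable xᵢ is represented by  var (i-1)  (index 0 = innermost binder).

data Tm (n : ℕ) : Set where
  var : Fin n → Tm n
  ƛ   : Tm (suc n) → Tm n
  _·_ : Tm n → Tm n → Tm n

infixl 7 _·_

data Value {n : ℕ} : Tm n → Set where
  var : (i : Fin n) → Value (var i)
  ƛ   : (t : Tm (suc n)) → Value (ƛ t)

ext : ∀ {m n} → (Fin m → Fin n) → Fin (suc m) → Fin (suc n)
ext ρ zero    = zero
ext ρ (suc i) = suc (ρ i)

rename : ∀ {m n} → (Fin m → Fin n) → Tm m → Tm n
rename ρ (var i) = var (ρ i)
rename ρ (ƛ t)   = ƛ (rename (ext ρ) t)
rename ρ (t · u) = rename ρ t · rename ρ u

weaken : ∀ {n} → Tm n → Tm (suc n)
weaken = rename suc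

exts : ∀ {m n} → (Fin m → Tm n) → Fin (suc m) → Tm (suc n)
exts σ zero    = var zero
exts σ (suc i) = weaken (σ i)

subst : ∀ {m n} → (Fin m → Tm n) → Tm m → Tm n
subst σ (var i) = σ i
subst σ (ƛ t)   = ƛ (subst (exts σ) t)
subst σ (t · u) = subst σ t · subst σ u

_[_/0] : ∀ {n} → Tm (suc n) → Tm n → Tm n
t [ v /0] = subst σ t
  where
    σ : Fin (suc _) → Tm _
    σ zero    = v
    σ (suc i) = var i

-- Root rules.  The side conditions x ∉ fv(s) and x ∉ fv(v) are expressed
-- by s (resp. v) living in the outer scope and being weakened under the
-- binder.

data _↦_ {n : ℕ} : Tm n → Tm n → Set where
  βv : ∀ {t : Tm (suc n)} {v : Tm n} → Value v → (ƛ t · v) ↦ (t [ v /0])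
  σ₁ : ∀ {t : Tm (suc n)} {u s : Tm n} →
       ((ƛ t · u) · s) ↦ (ƛ (t · weaken s) · u)
  σ₃ : ∀ {v : Tm n} {s : Tm (suc n)} {u : Tm n} → Value v →
       (v · (ƛ s · u)) ↦ (ƛ (weaken v · s) · u)

data _→sh_ {n : ℕ} : Tm n → Tm n → Set where
  root : ∀ {t u} → t ↦ u → t →sh u
  ƛ-c  : ∀ {t u : Tm (suc n)} → t →sh u → ƛ t →sh ƛ u
  ·-l  : ∀ {t t' s : Tm n} → t →sh t' → (t · s) →sh (t' · s)
  ·-r  : ∀ {t s s' : Tm n} → s →sh s' → (t · s) →sh (t · s')

_≃sh_ : ∀ {n} → Tm n → Tm n → Set
_≃sh_ = EqClosure _→sh_

-- Types.  Positive types are finite multisets of negative types, represented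
-- as lists taken up to the (nested) multiset equivalence _≈P_ below.

data Neg : Set where
  _⊸_ : List Neg → List Neg → Neg

Pos : Set
Pos = List Neg

𝟎 : Pos
𝟎 = []

data _≈N_ : Neg → Neg → Set
data _≈P_ : Pos → Pos → Set

data _≈N_ where
  ⊸-cong : ∀ {P P' Q Q'} → P ≈P P' → Q ≈P Q' → (P ⊸ Q) ≈N (P' ⊸ Q')

data _≈P_ where
  []    : [] ≈P []
  prep  : ∀ {N N' P P'} → N ≈N N' → P ≈P P' → (N ∷ P) ≈P (N' ∷ P')
  swap  : ∀ {N N' P} → (N ∷ N' ∷ P) ≈P (N' ∷ N ∷ P)
  trans : ∀ {P P' P''} → P ≈P P' → P' ≈P P'' → P ≈P P''

Env : ℕ → Set
Env k = Vec Pos k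

_≈E_ : ∀ {k} → Env k → Env k → Set
_≈E_ = Pointwise _≈P_

𝟎E : ∀ {k} → Env k
𝟎E {k} = replicate k 𝟎

_⊎E_ : ∀ {k} → Env k → Env k → Env k
_⊎E_ = zipWith _++_

-- Type system.  In (@) the two occurrences of P are compared as multisets.

data _⊢_∶_ {k : ℕ} : Env k → Tm k → Pos → Set
-- Γ ⊢λ t ∶ [P₁⊸Q₁,…,Pₙ⊸Qₙ] : the n premises of rule (λ), Γ = ⊎ᵢ Γᵢ
data _⊢λ_∶_ {k : ℕ} : Env k → Tm (suc k) → Pos → Set

data _⊢_∶_ {k} where
  ax  : ∀ (i : Fin k) (P : Pos) → (𝟎E [ i ]≔ P) ⊢ var i ∶ P
  app : ∀ {Γ Γ' t u P P' Q} →
        Γ ⊢ t ∶ ((P ⊸ Q) ∷ []) → Γ' ⊢ u ∶ P' → P ≈P P' →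
        (Γ ⊎E Γ') ⊢ (t · u) ∶ Q
  lam : ∀ {Γ t Ns} → Γ ⊢λ t ∶ Ns → Γ ⊢ ƛ t ∶ Ns

data _⊢λ_∶_ {k} where
  nil  : ∀ {t} → 𝟎E ⊢λ t ∶ []
  cons : ∀ {Γ Δ t P Q Ns} →
         (P ∷ Γ) ⊢ t ∶ Q → Δ ⊢λ t ∶ Ns →
         (Γ ⊎E Δ) ⊢λ t ∶ ((P ⊸ Q) ∷ Ns)

-- Semantics ⟦ t ⟧_x⃗ : the set of ((P₁,…,P_k),Q), types taken as multisets.

⟦_⟧ : ∀ {k} → Tm k → Pred (Env k × Pos) 0ℓ
⟦ t ⟧ (Ps , Q) = ∃[ Γ ] ∃[ Q' ] (Γ ≈E Ps × Q' ≈P Q × Γ ⊢ t ∶ Q')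

-- Values are duplicable: a typing of a value at a multiset P ++ P′ splits into
-- typings at P and P′ whose environments add up, and such typings merge back.
-- Consequently substitution of values is sound and complete for typing: Δ types
-- t{σ} iff, up to multiset equality, Δ is a sum of environments typing each σ x
-- at the type Γ(x) given to x by some typing Γ of t.  This gives invariance under βv.
-- The σ-rules move a redex past a subterm not mentioning the bound variable, which
-- is therefore typed with 𝟎 at that variable (weakening and its converse), so the
-- derivations are rebuilt from the same pieces with rearranged environments.
-- Typability is compositional, so invariance passes through contexts and along
-- the equivalence closure.

module Submission where

open import Defs
open import Data.Nat using (ℕ; zero; suc)
open import Data.Fin using (Fin; zero; suc; punchIn)
open import Data.List using ([]; _∷_; _++_; [_])
import Data.List.Properties as List
open import Data.List.Relation.Binary.Permutation.Propositional as ↭ using (_↭_)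
import Data.List.Relation.Binary.Permutation.Propositional.Properties as ↭ₚ
import Data.List.Relation.Binary.Pointwise as ListPointwise
open ListPointwise using ([]; _∷_)
open import Data.Vec using ([]; _∷_; insertAt; _[_]≔_)
import Data.Vec.Properties as Vec
import Data.Vec.Relation.Binary.Pointwise.Inductive as VecPointwise
open import Data.Vec.Relation.Binary.Pointwise.Inductive using ([]; _∷_)
open import Data.Product using (_×_; _,_; ∃-syntax; map)
open import Function using (_∘_)
open import Level using (0ℓ)
open import Algebra.Bundles using (CommutativeMonoid)
open import Algebra.Definitions using (Congruent₂)
open import Algebra.Structures using (IsCommutativeMonoid)
open import Relation.Binary.Core using (_⇒_)
open import Relation.Binary.Definitions using (Reflexive; Symmetric; Transitive)
open import Relation.Binary.Structures using (IsEquivalence)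
open import Relation.Binary.PropositionalEquality
  using (_≡_; refl; cong; sym; _≗_)
open import Relation.Unary using (Pred; _⊆_; _≐_)
open import Relation.Unary.Properties using (≐-refl; ≐-sym; ≐-trans)
import Relation.Binary.Construct.Closure.Equivalence as EqClosure

-- Multiset equality of types

≈N-refl : Reflexive _≈N_
≈P-refl : Reflexive _≈P_
≈N-refl {P ⊸ Q} = ⊸-cong ≈P-refl ≈P-refl
≈P-refl {[]}    = []
≈P-refl {N ∷ P} = prep ≈N-refl ≈P-refl

≈N-sym : Symmetric _≈N_
≈P-sym : Symmetric _≈P_
≈N-sym (⊸-cong p q) = ⊸-cong (≈P-sym p) (≈P-sym q)
≈P-sym []          = []
≈P-sym (prep n p)  = prep (≈N-sym n) (≈P-sym p)
≈P-sym swap        = swap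
≈P-sym (trans p q) = trans (≈P-sym q) (≈P-sym p)

≈N-trans : Transitive _≈N_
≈N-trans (⊸-cong p q) (⊸-cong p′ q′) = ⊸-cong (trans p p′) (trans q q′)

≈P-isEquivalence : IsEquivalence _≈P_
≈P-isEquivalence = record { refl = ≈P-refl ; sym = ≈P-sym ; trans = trans }

↭⇒≈P : _↭_ ⇒ _≈P_
↭⇒≈P ↭.refl           = ≈P-refl
↭⇒≈P (↭.prep N p)     = prep ≈N-refl (↭⇒≈P p)
↭⇒≈P (↭.swap N N′ p)  = trans swap (prep ≈N-refl (prep ≈N-refl (↭⇒≈P p)))
↭⇒≈P (↭.trans p q)    = trans (↭⇒≈P p) (↭⇒≈P q)

++-cong-≈P : Congruent₂ _≈P_ _++_
++-cong-≈P {_} {P′} {R} {R′} p r = trans (congˡ p) (congʳ P′ r)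
  where
  congˡ : ∀ {P P′} → P ≈P P′ → (P ++ R) ≈P (P′ ++ R)
  congˡ []          = ≈P-refl
  congˡ (prep n p)  = prep n (congˡ p)
  congˡ swap        = swap
  congˡ (trans p q) = trans (congˡ p) (congˡ q)
  congʳ : ∀ P → R ≈P R′ → (P ++ R) ≈P (P ++ R′)
  congʳ []      r = r
  congʳ (N ∷ P) r = prep ≈N-refl (congʳ P r)

++-isCommutativeMonoid-≈P : IsCommutativeMonoid _≈P_ _++_ 𝟎
++-isCommutativeMonoid-≈P = record
  { isMonoid = record
    { isSemigroup = record
      { isMagma = record { isEquivalence = ≈P-isEquivalence ; ∙-cong = ++-cong-≈P }
      ; assoc   = λ P Q R → ↭⇒≈P (assoc P Q R)
      }
    ; identity = (λ P → ↭⇒≈P (identityˡ P)) , (λ P → ↭⇒≈P (identityʳ P))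
    }
  ; comm = λ P Q → ↭⇒≈P (comm P Q)
  }
  where open IsCommutativeMonoid ↭ₚ.++-isCommutativeMonoid

module ≈P = IsCommutativeMonoid ++-isCommutativeMonoid-≈P

_≋_ : Pos → Pos → Set
_≋_ = ListPointwise.Pointwise _≈N_

≋⇒≈P : ∀ {P P′} → P ≋ P′ → P ≈P P′
≋⇒≈P []      = []
≋⇒≈P (n ∷ p) = prep n (≋⇒≈P p)

≋-↭-commute : ∀ {P Q R} → P ≋ Q → Q ↭ R → ∃[ S ] (P ↭ S × S ≋ R)
≋-↭-commute p ↭.refl = _ , ↭.refl , p
≋-↭-commute (n ∷ p) (↭.prep _ q) with ≋-↭-commute p q
... | _ , q′ , p′ = _ , ↭.prep _ q′ , n ∷ p′
≋-↭-commute (n ∷ n′ ∷ p) (↭.swap _ _ q) with ≋-↭-commute p q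
... | _ , q′ , p′ = _ , ↭.swap _ _ q′ , n′ ∷ n ∷ p′
≋-↭-commute p (↭.trans q r) with ≋-↭-commute p q
... | _ , q′ , p′ with ≋-↭-commute p′ r
... | _ , r′ , p″ = _ , ↭.trans q′ r′ , p″

≈P⇒↭≋ : ∀ {P P′} → P ≈P P′ → ∃[ R ] (P ↭ R × R ≋ P′)
≈P⇒↭≋ [] = [] , ↭.refl , []
≈P⇒↭≋ (prep n p) with ≈P⇒↭≋ p
... | _ , q , p′ = _ , ↭.prep _ q , n ∷ p′
≈P⇒↭≋ swap = _ , ↭.swap _ _ ↭.refl , ListPointwise.refl ≈N-refl
≈P⇒↭≋ (trans p q) with ≈P⇒↭≋ p | ≈P⇒↭≋ q
... | _ , p₁ , p₂ | _ , q₁ , q₂ with ≋-↭-commute p₂ q₁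
... | _ , r₁ , r₂ = _ , ↭.trans p₁ r₁ , ListPointwise.transitive ≈N-trans r₂ q₂

≈P-[]⁻ : ∀ {P} → P ≈P [] → P ≡ []
≈P-[]⁻ e with ≈P⇒↭≋ e
... | [] , p , [] = ↭ₚ.↭-empty-inv p

≈P-[-]⁻ : ∀ {P N} → P ≈P (N ∷ []) → ∃[ N′ ] (P ≡ N′ ∷ [] × N′ ≈N N)
≈P-[-]⁻ e with ≈P⇒↭≋ e
... | N′ ∷ [] , p , n ∷ [] = N′ , ↭ₚ.↭-singleton-inv p , n

≋-++⁻ : ∀ {R} Pa {Pb} → R ≋ (Pa ++ Pb) →
        ∃[ Ra ] ∃[ Rb ] (R ≡ Ra ++ Rb × Ra ≋ Pa × Rb ≋ Pb)
≋-++⁻ []       r = [] , _ , refl , [] , r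
≋-++⁻ (_ ∷ Pa) (n ∷ r) with ≋-++⁻ Pa r
... | _ , _ , refl , ra , rb = _ , _ , refl , n ∷ ra , rb

≈P-++⁻ : ∀ {P} Pa Pb → P ≈P (Pa ++ Pb) →
         ∃[ Ra ] ∃[ Rb ] (P ↭ Ra ++ Rb × Ra ≈P Pa × Rb ≈P Pb)
≈P-++⁻ Pa Pb e with ≈P⇒↭≋ e
... | _ , p , r with ≋-++⁻ Pa r
... | Ra , Rb , refl , ra , rb = Ra , Rb , p , ≋⇒≈P ra , ≋⇒≈P rb

⊎E-commutativeMonoid : ℕ → CommutativeMonoid 0ℓ 0ℓ
⊎E-commutativeMonoid k = record
  { Carrier             = Env k
  ; _≈_                 = _≈E_
  ; _∙_                 = _⊎E_
  ; ε                   = 𝟎E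
  ; isCommutativeMonoid = record
    { isMonoid = record
      { isSemigroup = record
        { isMagma = record
          { isEquivalence = VecPointwise.isEquivalence isEquivalence k
          ; ∙-cong        = VecPointwise.zipWith-cong ∙-cong
          }
        ; assoc   = VecPointwise.zipWith-assoc assoc
        }
      ; identity = VecPointwise.zipWith-identityˡ identityˡ
                 , VecPointwise.zipWith-identityʳ identityʳ
      }
    ; comm = VecPointwise.zipWith-comm comm
    }
  }
  where open IsCommutativeMonoid ++-isCommutativeMonoid-≈P

module ≈E {k : ℕ} where
  open CommutativeMonoid (⊎E-commutativeMonoid k) public
  open import Algebra.Properties.CommutativeSemigroup commutativeSemigroup public

⊎E-assoc : ∀ {k} (Γ Δ Θ : Env k) → ((Γ ⊎E Δ) ⊎E Θ) ≡ (Γ ⊎E (Δ ⊎E Θ))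
⊎E-assoc = Vec.zipWith-assoc List.++-assoc

⊎E-identityˡ : ∀ {k} (Γ : Env k) → (𝟎E ⊎E Γ) ≡ Γ
⊎E-identityˡ = Vec.zipWith-identityˡ List.++-identityˡ

≔-𝟎 : ∀ {k} (i : Fin k) → (𝟎E [ i ]≔ 𝟎) ≡ 𝟎E
≔-𝟎 zero    = refl
≔-𝟎 (suc i) = cong (𝟎 ∷_) (≔-𝟎 i)

≔-++ : ∀ {k} (i : Fin k) P R → (𝟎E [ i ]≔ (P ++ R)) ≡ ((𝟎E [ i ]≔ P) ⊎E (𝟎E [ i ]≔ R))
≔-++ zero    P R = cong ((P ++ R) ∷_) (sym (⊎E-identityˡ 𝟎E))
≔-++ (suc i) P R = cong (𝟎 ∷_) (≔-++ i P R)

≔-cong : ∀ {k} (i : Fin k) {P P′} → P ≈P P′ → (𝟎E [ i ]≔ P) ≈E (𝟎E [ i ]≔ P′)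
≔-cong zero    p = p ∷ ≈E.refl
≔-cong (suc i) p = [] ∷ ≔-cong i p

infix 4 _⊨_∶_
_⊨_∶_ : ∀ {k} → Env k → Tm k → Pos → Set
Γ ⊨ t ∶ Q = ⟦ t ⟧ (Γ , Q)

⊨-resp-≈ : ∀ {k} {t : Tm k} {Γ Γ′ Q Q′} → Γ ⊨ t ∶ Q → Γ ≈E Γ′ → Q ≈P Q′ → Γ′ ⊨ t ∶ Q′
⊨-resp-≈ (Γ₀ , Q₀ , γ , q , D) γ′ q′ = Γ₀ , Q₀ , ≈E.trans γ γ′ , ≈P.trans q q′ , D

⊢⇒⊨ : ∀ {k} {t : Tm k} {Γ Q} → Γ ⊢ t ∶ Q → Γ ⊨ t ∶ Q
⊢⇒⊨ D = _ , _ , ≈E.refl , ≈P.refl , D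

⟦⟧-⊆ : ∀ {k} {t u : Tm k} → (∀ {Γ Q} → Γ ⊢ t ∶ Q → Γ ⊨ u ∶ Q) → ⟦ t ⟧ ⊆ ⟦ u ⟧
⟦⟧-⊆ f (_ , _ , γ , q , D) = ⊨-resp-≈ (f D) γ q

var-⊨⁻ : ∀ {k} {i : Fin k} {Δ P} → Δ ⊨ var i ∶ P → Δ ≈E (𝟎E [ i ]≔ P)
var-⊨⁻ {i = i} (_ , _ , γ , p , ax .i _) = ≈E.trans (≈E.sym γ) (≔-cong i p)

app-⊨ : ∀ {k} {t u : Tm k} {Γ Δ P P′ Q} →
        Γ ⊨ t ∶ [ P ⊸ Q ] → Δ ⊨ u ∶ P′ → P ≈P P′ → (Γ ⊎E Δ) ⊨ t · u ∶ Q
app-⊨ (_ , _ , γ , n , Dt) (_ , _ , δ , p , Du) e with ≈P-[-]⁻ n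
... | _ , refl , ⊸-cong p₁ q₁ =
  _ , _ , ≈E.∙-cong γ δ , q₁ , app Dt Du (≈P.trans p₁ (≈P.trans e (≈P.sym p)))

lam-cons-⊨ : ∀ {k} {t : Tm (suc k)} {Γ Δ P Q Ns} →
             (P ∷ Γ) ⊨ t ∶ Q → Δ ⊨ ƛ t ∶ Ns → (Γ ⊎E Δ) ⊨ ƛ t ∶ ((P ⊸ Q) ∷ Ns)
lam-cons-⊨ (_ ∷ _ , _ , p ∷ γ , q , Dt) (_ , _ , δ , ns , lam Ds) =
  _ , _ , ≈E.∙-cong γ δ , prep (⊸-cong p q) ns , lam (cons Dt Ds)

⊢λ-++ : ∀ {k} {t : Tm (suc k)} {Γ Δ Ns Ms} →
        Γ ⊢λ t ∶ Ns → Δ ⊢λ t ∶ Ms → (Γ ⊎E Δ) ⊢λ t ∶ (Ns ++ Ms)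
⊢λ-++ {Δ = Δ} nil Ds rewrite ⊎E-identityˡ Δ = Ds
⊢λ-++ {Δ = Δ′} (cons {Γ = Γ} {Δ = Δ} Dt Ds) Ds′ rewrite ⊎E-assoc Γ Δ Δ′ = cons Dt (⊢λ-++ Ds Ds′)

⊢λ-++⁻ : ∀ {k} {t : Tm (suc k)} {Γ} Ns {Ms} → Γ ⊢λ t ∶ (Ns ++ Ms) →
         ∃[ Γa ] ∃[ Γb ] (Γ ≡ (Γa ⊎E Γb) × Γa ⊢λ t ∶ Ns × Γb ⊢λ t ∶ Ms)
⊢λ-++⁻ []       Ds = 𝟎E , _ , sym (⊎E-identityˡ _) , nil , Ds
⊢λ-++⁻ (_ ∷ Ns) (cons {Γ = Γ} Dt Ds) with ⊢λ-++⁻ Ns Ds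
... | Γa , Γb , refl , Dsa , Dsb = (Γ ⊎E Γa) , Γb , sym (⊎E-assoc Γ Γa Γb) , cons Dt Dsa , Dsb

⊢λ-↭ : ∀ {k} {t : Tm (suc k)} {Γ Ns Ms} →
       Γ ⊢λ t ∶ Ns → Ns ↭ Ms → ∃[ Γ′ ] (Γ′ ≈E Γ × Γ′ ⊢λ t ∶ Ms)
⊢λ-↭ Ds ↭.refl = _ , ≈E.refl , Ds
⊢λ-↭ (cons Dt Ds) (↭.prep _ p) with ⊢λ-↭ Ds p
... | _ , γ , Ds′ = _ , ≈E.∙-congˡ γ , cons Dt Ds′
⊢λ-↭ (cons {Γ = Γ₁} D₁ (cons {Γ = Γ₂} {Δ = Δ} D₂ Ds)) (↭.swap _ _ p) with ⊢λ-↭ Ds p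
... | Γ′ , γ , Ds′ =
  (Γ₂ ⊎E (Γ₁ ⊎E Γ′)) , ≈E.trans (≈E.∙-congˡ (≈E.∙-congˡ γ)) (≈E.x∙yz≈y∙xz Γ₂ Γ₁ Δ) ,
  cons D₂ (cons D₁ Ds′)
⊢λ-↭ Ds (↭.trans p q) with ⊢λ-↭ Ds p
... | _ , γ , Ds′ with ⊢λ-↭ Ds′ q
... | _ , γ′ , Ds″ = _ , ≈E.trans γ′ γ , Ds″

-- Typings of values

value-𝟎 : ∀ {k} {v : Tm k} → Value v → 𝟎E ⊨ v ∶ 𝟎
value-𝟎 (var i) = ⊨-resp-≈ (⊢⇒⊨ (ax i 𝟎)) (≈E.reflexive (≔-𝟎 i)) ≈P.refl
value-𝟎 (ƛ t)   = ⊢⇒⊨ (lam nil)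

value-𝟎⁻ : ∀ {k} {v : Tm k} {Δ} → Value v → Δ ⊨ v ∶ 𝟎 → Δ ≈E 𝟎E
value-𝟎⁻ (var i) d = ≈E.trans (var-⊨⁻ d) (≈E.reflexive (≔-𝟎 i))
value-𝟎⁻ (ƛ t) (_ , _ , γ , r , lam Ds) with ≈P-[]⁻ r
value-𝟎⁻ (ƛ t) (_ , _ , γ , r , lam nil) | refl = ≈E.sym γ

value-++ : ∀ {k} {v : Tm k} {Δa Δb Pa Pb} → Value v →
           Δa ⊨ v ∶ Pa → Δb ⊨ v ∶ Pb → (Δa ⊎E Δb) ⊨ v ∶ (Pa ++ Pb)
value-++ (var i) (_ , Ra , γa , ra , ax .i .Ra) (_ , Rb , γb , rb , ax .i .Rb) =
  ⊨-resp-≈ (⊢⇒⊨ (ax i (Ra ++ Rb))) (≈E.trans (≈E.reflexive (≔-++ i Ra Rb)) (≈E.∙-cong γa γb))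
           (≈P.∙-cong ra rb)
value-++ (ƛ t) (_ , _ , γa , ra , lam Dsa) (_ , _ , γb , rb , lam Dsb) =
  ⊨-resp-≈ (⊢⇒⊨ (lam (⊢λ-++ Dsa Dsb))) (≈E.∙-cong γa γb) (≈P.∙-cong ra rb)

value-++⁻ : ∀ {k} {v : Tm k} {Δ} Pa Pb → Value v → Δ ⊨ v ∶ (Pa ++ Pb) →
            ∃[ Δa ] ∃[ Δb ] (Δ ≈E (Δa ⊎E Δb) × Δa ⊨ v ∶ Pa × Δb ⊨ v ∶ Pb)
value-++⁻ Pa Pb V (_ , _ , γ , r , D) with ≈P-++⁻ Pa Pb r
value-++⁻ Pa Pb (var i) (_ , _ , γ , r , ax .i _) | Ra , Rb , p , ra , rb =
  _ , _ , ≈E.trans (≈E.sym γ) (≈E.trans (≔-cong i (↭⇒≈P p)) (≈E.reflexive (≔-++ i Ra Rb))) ,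
  ⊨-resp-≈ (⊢⇒⊨ (ax i Ra)) ≈E.refl ra , ⊨-resp-≈ (⊢⇒⊨ (ax i Rb)) ≈E.refl rb
value-++⁻ Pa Pb (ƛ t) (_ , _ , γ , r , lam Ds) | Ra , Rb , p , ra , rb with ⊢λ-↭ Ds p
... | _ , γ′ , Ds′ with ⊢λ-++⁻ Ra Ds′
... | Γa , Γb , refl , Dsa , Dsb =
  Γa , Γb , ≈E.trans (≈E.sym γ) (≈E.sym γ′) ,
  ⊨-resp-≈ (⊢⇒⊨ (lam Dsa)) ≈E.refl ra , ⊨-resp-≈ (⊢⇒⊨ (lam Dsb)) ≈E.refl rb

-- Weakening

insertAt-𝟎E : ∀ {n} (p : Fin (suc n)) → insertAt (𝟎E {n}) p 𝟎 ≡ 𝟎E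
insertAt-𝟎E         zero    = refl
insertAt-𝟎E {suc n} (suc p) = cong (𝟎 ∷_) (insertAt-𝟎E p)

insertAt-≔ : ∀ {n} (p : Fin (suc n)) (i : Fin n) P →
             insertAt (𝟎E [ i ]≔ P) p 𝟎 ≡ (𝟎E [ punchIn p i ]≔ P)
insertAt-≔ zero    i       P = refl
insertAt-≔ (suc p) zero    P = cong (P ∷_) (insertAt-𝟎E p)
insertAt-≔ (suc p) (suc i) P = cong (𝟎 ∷_) (insertAt-≔ p i P)

insertAt-⊎E : ∀ {n} (p : Fin (suc n)) (Γ Δ : Env n) →
              insertAt (Γ ⊎E Δ) p 𝟎 ≡ (insertAt Γ p 𝟎 ⊎E insertAt Δ p 𝟎)
insertAt-⊎E zero    Γ       Δ       = refl
insertAt-⊎E (suc p) (P ∷ Γ) (Q ∷ Δ) = cong ((P ++ Q) ∷_) (insertAt-⊎E p Γ Δ)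

ext-punchIn : ∀ {m} {ρ : Fin m → Fin (suc m)} {p} → ρ ≗ punchIn p → ext ρ ≗ punchIn (suc p)
ext-punchIn ρ≗ zero    = refl
ext-punchIn ρ≗ (suc i) = cong suc (ρ≗ i)

rename-punchIn⁺ : ∀ {m} {ρ : Fin m → Fin (suc m)} {p} → ρ ≗ punchIn p →
                  ∀ {Γ t Q} → Γ ⊢ t ∶ Q → insertAt Γ p 𝟎 ⊢ rename ρ t ∶ Q
rename-punchIn⁺λ : ∀ {m} {ρ : Fin m → Fin (suc m)} {p} → ρ ≗ punchIn p →
                   ∀ {Γ t Ns} → Γ ⊢λ t ∶ Ns → insertAt Γ p 𝟎 ⊢λ rename (ext ρ) t ∶ Ns
rename-punchIn⁺ {p = p} ρ≗ (ax i P)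
  rewrite insertAt-≔ p i P | ρ≗ i = ax (punchIn p i) P
rename-punchIn⁺ {p = p} ρ≗ (app {Γ = Γ} {Γ′} Dt Du e)
  rewrite insertAt-⊎E p Γ Γ′ = app (rename-punchIn⁺ ρ≗ Dt) (rename-punchIn⁺ ρ≗ Du) e
rename-punchIn⁺ ρ≗ (lam Ds) = lam (rename-punchIn⁺λ ρ≗ Ds)
rename-punchIn⁺λ {p = p} ρ≗ nil rewrite insertAt-𝟎E p = nil
rename-punchIn⁺λ {p = p} ρ≗ (cons {Γ = Γ} {Δ = Δ} Dt Ds)
  rewrite insertAt-⊎E p Γ Δ = cons (rename-punchIn⁺ (ext-punchIn ρ≗) Dt) (rename-punchIn⁺λ ρ≗ Ds)

rename-punchIn⁻ : ∀ {m} {ρ : Fin m → Fin (suc m)} {p} → ρ ≗ punchIn p →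
                  ∀ {E Q} (t : Tm m) → E ⊢ rename ρ t ∶ Q → ∃[ Γ ] (E ≡ insertAt Γ p 𝟎 × Γ ⊢ t ∶ Q)
rename-punchIn⁻λ : ∀ {m} {ρ : Fin m → Fin (suc m)} {p} → ρ ≗ punchIn p →
                   ∀ {E Ns} (t : Tm (suc m)) → E ⊢λ rename (ext ρ) t ∶ Ns →
                   ∃[ Γ ] (E ≡ insertAt Γ p 𝟎 × Γ ⊢λ t ∶ Ns)
rename-punchIn⁻ {ρ = ρ} {p} ρ≗ (var j) (ax .(ρ j) P)
  rewrite ρ≗ j = _ , sym (insertAt-≔ p j P) , ax j P
rename-punchIn⁻ ρ≗ (ƛ t) (lam Ds) with rename-punchIn⁻λ ρ≗ t Ds
... | Γ , refl , Ds′ = Γ , refl , lam Ds′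
rename-punchIn⁻ {p = p} ρ≗ (t · u) (app Dt Du e) with rename-punchIn⁻ ρ≗ t Dt | rename-punchIn⁻ ρ≗ u Du
... | Γ , refl , Dt′ | Δ , refl , Du′ = (Γ ⊎E Δ) , sym (insertAt-⊎E p Γ Δ) , app Dt′ Du′ e
rename-punchIn⁻λ {p = p} ρ≗ t nil = 𝟎E , sym (insertAt-𝟎E p) , nil
rename-punchIn⁻λ {p = p} ρ≗ t (cons Dt Ds)
  with rename-punchIn⁻ (ext-punchIn ρ≗) t Dt | rename-punchIn⁻λ ρ≗ t Ds
... | _ ∷ Γ , refl , Dt′ | Δ , refl , Ds′ = (Γ ⊎E Δ) , sym (insertAt-⊎E p Γ Δ) , cons Dt′ Ds′

⊢-weaken : ∀ {k} {Γ : Env k} {t Q} → Γ ⊢ t ∶ Q → (𝟎 ∷ Γ) ⊢ weaken t ∶ Q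
⊢-weaken = rename-punchIn⁺ {p = zero} (λ _ → refl)

⊢-weaken⁻ : ∀ {k} {E : Env (suc k)} {t Q} → E ⊢ weaken t ∶ Q → ∃[ Γ ] (E ≡ (𝟎 ∷ Γ) × Γ ⊢ t ∶ Q)
⊢-weaken⁻ = rename-punchIn⁻ {p = zero} (λ _ → refl) _

⊨-weaken : ∀ {k} {t : Tm k} {Δ P} → Δ ⊨ t ∶ P → (𝟎 ∷ Δ) ⊨ weaken t ∶ P
⊨-weaken (_ , _ , γ , p , D) = _ , _ , [] ∷ γ , p , ⊢-weaken D

⊨-weaken⁻ : ∀ {k} {t : Tm k} {E : Env (suc k)} {P} → E ⊨ weaken t ∶ P → ∃[ Δ ] (E ≈E (𝟎 ∷ Δ) × Δ ⊨ t ∶ P)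
⊨-weaken⁻ {E = _ ∷ E} (_ , _ , γ , p , D) with ⊢-weaken⁻ D
... | _ , refl , D′ with γ
... | p₀ ∷ γ′ = E , ≈P.sym p₀ ∷ ≈E.refl , (_ , _ , γ′ , p , D′)

-- Substitutions of values

Values : ∀ {m n} → (Fin m → Tm n) → Set
Values σ = ∀ i → Value (σ i)

Values-exts : ∀ {m n} {σ : Fin m → Tm n} → Values σ → Values (exts σ)
Values-exts V zero    = var zero
Values-exts V (suc i) = Value-rename (V i)
  where
  Value-rename : ∀ {m n} {ρ : Fin m → Fin n} {v} → Value v → Value (rename ρ v)
  Value-rename (var i) = var _
  Value-rename (ƛ t)   = ƛ _

infix 4 _⊩_∶_
_⊩_∶_ : ∀ {m n} → Env n → (Fin m → Tm n) → Env m → Set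
Δ ⊩ σ ∶ []      = Δ ≈E 𝟎E
Δ ⊩ σ ∶ (P ∷ Γ) = ∃[ Δ₁ ] ∃[ Δ₂ ] (Δ ≈E (Δ₁ ⊎E Δ₂) × Δ₁ ⊨ σ zero ∶ P × Δ₂ ⊩ σ ∘ suc ∶ Γ)

⊩-resp-≈ : ∀ {m n} {σ : Fin m → Tm n} {Γ Δ Δ′} → Δ ⊩ σ ∶ Γ → Δ ≈E Δ′ → Δ′ ⊩ σ ∶ Γ
⊩-resp-≈ {Γ = []}    s                    δ = ≈E.trans (≈E.sym δ) s
⊩-resp-≈ {Γ = _ ∷ _} (Δ₁ , Δ₂ , δ₁ , d , s) δ = Δ₁ , Δ₂ , ≈E.trans (≈E.sym δ) δ₁ , d , s

⊩-𝟎 : ∀ {m n} {σ : Fin m → Tm n} → Values σ → 𝟎E ⊩ σ ∶ 𝟎E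
⊩-𝟎 {zero}  V = ≈E.refl
⊩-𝟎 {suc m} V = 𝟎E , 𝟎E , ≈E.sym (≈E.identityˡ 𝟎E) , value-𝟎 (V zero) , ⊩-𝟎 (V ∘ suc)

⊩-𝟎⁻ : ∀ {m n} {σ : Fin m → Tm n} {Δ} → Values σ → Δ ⊩ σ ∶ 𝟎E → Δ ≈E 𝟎E
⊩-𝟎⁻ {zero}  V s                    = s
⊩-𝟎⁻ {suc m} V (_ , _ , δ , d , s) =
  ≈E.trans δ (≈E.trans (≈E.∙-cong (value-𝟎⁻ (V zero) d) (⊩-𝟎⁻ (V ∘ suc) s)) (≈E.identityˡ 𝟎E))

⊩-≔ : ∀ {m n} {σ : Fin m → Tm n} {Δ P} → Values σ → ∀ i → Δ ⊨ σ i ∶ P → Δ ⊩ σ ∶ (𝟎E [ i ]≔ P)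
⊩-≔ V zero    d = _ , 𝟎E , ≈E.sym (≈E.identityʳ _) , d , ⊩-𝟎 (V ∘ suc)
⊩-≔ V (suc i) d = 𝟎E , _ , ≈E.sym (≈E.identityˡ _) , value-𝟎 (V zero) , ⊩-≔ (V ∘ suc) i d

⊩-≔⁻ : ∀ {m n} {σ : Fin m → Tm n} {Δ P} → Values σ → ∀ i → Δ ⊩ σ ∶ (𝟎E [ i ]≔ P) → Δ ⊨ σ i ∶ P
⊩-≔⁻ V zero (Δ₁ , _ , δ , d , s) =
  ⊨-resp-≈ d (≈E.sym (≈E.trans δ (≈E.trans (≈E.∙-congˡ (⊩-𝟎⁻ (V ∘ suc) s)) (≈E.identityʳ Δ₁)))) ≈P.refl
⊩-≔⁻ V (suc i) (_ , Δ₂ , δ , d , s) =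
  ⊨-resp-≈ (⊩-≔⁻ (V ∘ suc) i s)
    (≈E.sym (≈E.trans δ (≈E.trans (≈E.∙-congʳ (value-𝟎⁻ (V zero) d)) (≈E.identityˡ Δ₂)))) ≈P.refl

⊩-⊎E : ∀ {m n} {σ : Fin m → Tm n} {Γ₁ Γ₂ Δ₁ Δ₂} → Values σ →
       Δ₁ ⊩ σ ∶ Γ₁ → Δ₂ ⊩ σ ∶ Γ₂ → (Δ₁ ⊎E Δ₂) ⊩ σ ∶ (Γ₁ ⊎E Γ₂)
⊩-⊎E {Γ₁ = []}    {[]}    V s₁ s₂ = ≈E.trans (≈E.∙-cong s₁ s₂) (≈E.identityˡ 𝟎E)
⊩-⊎E {Γ₁ = _ ∷ _} {_ ∷ _} V (a₁ , b₁ , δ₁ , d₁ , s₁) (a₂ , b₂ , δ₂ , d₂ , s₂) =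
  (a₁ ⊎E a₂) , (b₁ ⊎E b₂) , ≈E.trans (≈E.∙-cong δ₁ δ₂) (≈E.interchange a₁ b₁ a₂ b₂) ,
  value-++ (V zero) d₁ d₂ , ⊩-⊎E (V ∘ suc) s₁ s₂

⊩-⊎E⁻ : ∀ {m n} {σ : Fin m → Tm n} (Γ₁ Γ₂ : Env m) {Δ} → Values σ → Δ ⊩ σ ∶ (Γ₁ ⊎E Γ₂) →
        ∃[ Δ₁ ] ∃[ Δ₂ ] (Δ ≈E (Δ₁ ⊎E Δ₂) × Δ₁ ⊩ σ ∶ Γ₁ × Δ₂ ⊩ σ ∶ Γ₂)
⊩-⊎E⁻ []        []        V s = 𝟎E , 𝟎E , ≈E.trans s (≈E.sym (≈E.identityˡ 𝟎E)) , ≈E.refl , ≈E.refl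
⊩-⊎E⁻ (P₁ ∷ Γ₁) (P₂ ∷ Γ₂) V (_ , _ , δ , d , s)
  with value-++⁻ P₁ P₂ (V zero) d | ⊩-⊎E⁻ Γ₁ Γ₂ (V ∘ suc) s
... | a₁ , a₂ , δa , d₁ , d₂ | b₁ , b₂ , δb , s₁ , s₂ =
  (a₁ ⊎E b₁) , (a₂ ⊎E b₂) , ≈E.trans δ (≈E.trans (≈E.∙-cong δa δb) (≈E.interchange a₁ a₂ b₁ b₂)) ,
  (a₁ , b₁ , ≈E.refl , d₁ , s₁) , (a₂ , b₂ , ≈E.refl , d₂ , s₂)

⊩-weaken : ∀ {m n} {σ : Fin m → Tm n} {Γ Δ} → Δ ⊩ σ ∶ Γ → (𝟎 ∷ Δ) ⊩ weaken ∘ σ ∶ Γ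
⊩-weaken {Γ = []}    s                   = [] ∷ s
⊩-weaken {Γ = _ ∷ _} (_ , _ , δ , d , s) = _ , _ , [] ∷ δ , ⊨-weaken d , ⊩-weaken s

⊩-weaken⁻ : ∀ {m n} {σ : Fin m → Tm n} {Γ E} → E ⊩ weaken ∘ σ ∶ Γ → ∃[ Δ ] (E ≈E (𝟎 ∷ Δ) × Δ ⊩ σ ∶ Γ)
⊩-weaken⁻ {Γ = []} {_ ∷ E} (p ∷ s) = E , p ∷ ≈E.refl , s
⊩-weaken⁻ {Γ = _ ∷ _} (_ , _ , δ , d , s) with ⊨-weaken⁻ d | ⊩-weaken⁻ s
... | Δ₁ , δ₁ , d′ | Δ₂ , δ₂ , s′ =
  (Δ₁ ⊎E Δ₂) , ≈E.trans δ (≈E.∙-cong δ₁ δ₂) , (Δ₁ , Δ₂ , ≈E.refl , d′ , s′)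

⊩-exts : ∀ {m n} {σ : Fin m → Tm n} {Γ Δ P} → Δ ⊩ σ ∶ Γ → (P ∷ Δ) ⊩ exts σ ∶ (P ∷ Γ)
⊩-exts {Δ = Δ} {P} s =
  (P ∷ 𝟎E) , (𝟎 ∷ Δ) , ≈P.sym (≈P.identityʳ P) ∷ ≈E.sym (≈E.identityˡ Δ) , ⊢⇒⊨ (ax zero P) , ⊩-weaken s

⊩-exts⁻ : ∀ {m n} {σ : Fin m → Tm n} {Γ E P} → E ⊩ exts σ ∶ (P ∷ Γ) → ∃[ Δ ] (E ≈E (P ∷ Δ) × Δ ⊩ σ ∶ Γ)
⊩-exts⁻ {P = P} (_ , _ , δ , d , s) with ⊩-weaken⁻ s
... | Δ , δ₂ , s′ =
  Δ , ≈E.trans δ (≈E.trans (≈E.∙-cong (var-⊨⁻ d) δ₂) (≈P.identityʳ P ∷ ≈E.identityˡ Δ)) , s′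

⊩-id : ∀ {m} (Γ : Env m) → Γ ⊩ var ∶ Γ
⊩-id []      = ≈E.refl
⊩-id (P ∷ Γ) = ⊩-exts (⊩-id Γ)

⊩-id⁻ : ∀ {m} (Γ : Env m) {Δ} → Δ ⊩ var ∶ Γ → Δ ≈E Γ
⊩-id⁻ []      s = s
⊩-id⁻ (P ∷ Γ) s with ⊩-exts⁻ {σ = var} s
... | _ , δ , s′ = ≈E.trans δ (≈P.refl ∷ ⊩-id⁻ Γ s′)

subst⁺ : ∀ {m n} {σ : Fin m → Tm n} {Γ t Q Δ} → Values σ → Γ ⊢ t ∶ Q → Δ ⊩ σ ∶ Γ → Δ ⊨ subst σ t ∶ Q
subst⁺λ : ∀ {m n} {σ : Fin m → Tm n} {Γ t Ns Δ} →
          Values σ → Γ ⊢λ t ∶ Ns → Δ ⊩ σ ∶ Γ → Δ ⊨ ƛ (subst (exts σ) t) ∶ Ns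
subst⁺ V (ax i P) s = ⊩-≔⁻ V i s
subst⁺ V (app {Γ = Γ₁} {Γ₂} Dt Du e) s with ⊩-⊎E⁻ Γ₁ Γ₂ V s
... | _ , _ , δ , s₁ , s₂ = ⊨-resp-≈ (app-⊨ (subst⁺ V Dt s₁) (subst⁺ V Du s₂) e) (≈E.sym δ) ≈P.refl
subst⁺ V (lam Ds) s = subst⁺λ V Ds s
subst⁺λ V nil s = ⊨-resp-≈ (⊢⇒⊨ (lam nil)) (≈E.sym (⊩-𝟎⁻ V s)) ≈P.refl
subst⁺λ V (cons {Γ = Γ₁} {Δ = Γ₂} Dt Ds) s with ⊩-⊎E⁻ Γ₁ Γ₂ V s
... | _ , _ , δ , s₁ , s₂ =
  ⊨-resp-≈ (lam-cons-⊨ (subst⁺ (Values-exts V) Dt (⊩-exts s₁)) (subst⁺λ V Ds s₂)) (≈E.sym δ) ≈P.refl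

subst⁻ : ∀ {m n} {σ : Fin m → Tm n} {E Q} → Values σ → (t : Tm m) → E ⊢ subst σ t ∶ Q →
         ∃[ Γ ] (Γ ⊨ t ∶ Q × E ⊩ σ ∶ Γ)
subst⁻λ : ∀ {m n} {σ : Fin m → Tm n} {E Ns} → Values σ → (t : Tm (suc m)) → E ⊢λ subst (exts σ) t ∶ Ns →
          ∃[ Γ ] (Γ ⊨ ƛ t ∶ Ns × E ⊩ σ ∶ Γ)
subst⁻ {Q = Q} V (var i) D = (𝟎E [ i ]≔ Q) , ⊢⇒⊨ (ax i Q) , ⊩-≔ V i (⊢⇒⊨ D)
subst⁻ V (ƛ t) (lam Ds) = subst⁻λ V t Ds
subst⁻ V (t · u) (app Dt Du e) with subst⁻ V t Dt | subst⁻ V u Du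
... | Γ₁ , dt , s₁ | Γ₂ , du , s₂ = (Γ₁ ⊎E Γ₂) , app-⊨ dt du e , ⊩-⊎E V s₁ s₂
subst⁻λ V t nil = 𝟎E , ⊢⇒⊨ (lam nil) , ⊩-𝟎 V
subst⁻λ V t (cons Dt Ds) with subst⁻ (Values-exts V) t Dt | subst⁻λ V t Ds
... | _ ∷ Γ₁ , dt , s₁ | Γ₂ , ds , s₂ with ⊩-exts⁻ s₁
... | _ , p ∷ δ , s₁′ =
  (Γ₁ ⊎E Γ₂) , ⊨-resp-≈ (lam-cons-⊨ dt ds) ≈E.refl (prep (⊸-cong (≈P.sym p) ≈P.refl) ≈P.refl) ,
  ⊩-resp-≈ (⊩-⊎E V s₁′ s₂) (≈E.∙-congʳ (≈E.sym δ))

-- Invariance under the rules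

redex-⊨ : ∀ {k} {t : Tm (suc k)} {u : Tm k} {Γ Δ P P′ Q} →
          (P ∷ Γ) ⊨ t ∶ Q → Δ ⊨ u ∶ P′ → P ≈P P′ → (Γ ⊎E Δ) ⊨ ƛ t · u ∶ Q
redex-⊨ {Γ = Γ} dt du e =
  ⊨-resp-≈ (app-⊨ (lam-cons-⊨ dt (⊢⇒⊨ (lam nil))) du e) (≈E.∙-congʳ (≈E.identityʳ Γ)) ≈P.refl

module _ {k} {t : Tm (suc k)} {v : Tm k} (V : Value v) where

  βv-⊆ : ⟦ ƛ t · v ⟧ ⊆ ⟦ t [ v /0] ⟧
  βv-⊆ = ⟦⟧-⊆ λ where
    (app (lam (cons {Γ = Γ} Dt nil)) Dv e) →
      ⊨-resp-≈ (subst⁺ (λ { zero → V ; (suc i) → var i }) Dt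
                       (_ , Γ , ≈E.refl , ⊨-resp-≈ (⊢⇒⊨ Dv) ≈E.refl (≈P.sym e) , ⊩-id Γ))
               (≈E.trans (≈E.comm _ Γ) (≈E.∙-congʳ (≈E.sym (≈E.identityʳ Γ)))) ≈P.refl

  βv-⊇ : ⟦ t [ v /0] ⟧ ⊆ ⟦ ƛ t · v ⟧
  βv-⊇ = ⟦⟧-⊆ from-⊢
    where
    from-⊢ : ∀ {Γ Q} → Γ ⊢ t [ v /0] ∶ Q → Γ ⊨ ƛ t · v ∶ Q
    from-⊢ D with subst⁻ (λ { zero → V ; (suc i) → var i }) t D
    ... | _ ∷ Γ , dt , (Δ₁ , Δ₂ , δ , dv , s) =
      ⊨-resp-≈ (redex-⊨ dt dv ≈P.refl)
               (≈E.trans (≈E.∙-congʳ (≈E.sym (⊩-id⁻ Γ s))) (≈E.trans (≈E.comm Δ₂ Δ₁) (≈E.sym δ))) ≈P.refl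

app-weakenʳ⁻ : ∀ {k} {E : Env (suc k)} {t s Q} → E ⊢ t · weaken s ∶ Q →
               ∃[ E₁ ] ∃[ Γs ] ∃[ P ] ∃[ P′ ]
                 (E ≡ (E₁ ⊎E (𝟎 ∷ Γs)) × E₁ ⊢ t ∶ [ P ⊸ Q ] × Γs ⊢ s ∶ P′ × P ≈P P′)
app-weakenʳ⁻ (app Dt Dws e) with ⊢-weaken⁻ Dws
... | _ , refl , Ds = _ , _ , _ , _ , refl , Dt , Ds , e

app-weakenˡ⁻ : ∀ {k} {E : Env (suc k)} {v s Q} → E ⊢ weaken v · s ∶ Q →
               ∃[ Γv ] ∃[ E₂ ] ∃[ P ] ∃[ P′ ]
                 (E ≡ ((𝟎 ∷ Γv) ⊎E E₂) × Γv ⊢ v ∶ [ P ⊸ Q ] × E₂ ⊢ s ∶ P′ × P ≈P P′)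
app-weakenˡ⁻ (app Dwv Ds e) with ⊢-weaken⁻ Dwv
... | _ , refl , Dv = _ , _ , _ , _ , refl , Dv , Ds , e

module _ {k} {t : Tm (suc k)} {u s : Tm k} where

  σ₁-⊆ : ⟦ (ƛ t · u) · s ⟧ ⊆ ⟦ ƛ (t · weaken s) · u ⟧
  σ₁-⊆ = ⟦⟧-⊆ λ where
    (app {Γ' = Γs} (app {Γ' = Γu} (lam (cons {Γ = Γ} {P = R} Dt nil)) Du e₁) Ds e₂) →
      ⊨-resp-≈ (redex-⊨ (⊢⇒⊨ (app Dt (⊢-weaken Ds) e₂)) (⊢⇒⊨ Du) (≈P.trans (≈P.identityʳ R) e₁))
               (≈E.trans (≈E.xy∙z≈xz∙y Γ Γs Γu) (≈E.∙-congʳ (≈E.∙-congʳ (≈E.sym (≈E.identityʳ Γ)))))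
               ≈P.refl

  σ₁-⊇ : ⟦ ƛ (t · weaken s) · u ⟧ ⊆ ⟦ (ƛ t · u) · s ⟧
  σ₁-⊇ = ⟦⟧-⊆ from-⊢
    where
    from-⊢ : ∀ {Γ Q} → Γ ⊢ ƛ (t · weaken s) · u ∶ Q → Γ ⊨ (ƛ t · u) · s ∶ Q
    from-⊢ (app {Γ' = Γu} (lam (cons Dts nil)) Du e₁) with app-weakenʳ⁻ Dts
    ... | R ∷ Γ , Γs , _ , _ , refl , Dt , Ds , e =
      ⊨-resp-≈ (app-⊨ (redex-⊨ (⊢⇒⊨ Dt) (⊢⇒⊨ Du) (≈P.trans (≈P.sym (≈P.identityʳ R)) e₁)) (⊢⇒⊨ Ds) e)
               (≈E.trans (≈E.xy∙z≈xz∙y Γ Γu Γs) (≈E.∙-congʳ (≈E.sym (≈E.identityʳ _))))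
               ≈P.refl

module _ {k} {v : Tm k} {s : Tm (suc k)} {u : Tm k} where

  σ₃-⊆ : ⟦ v · (ƛ s · u) ⟧ ⊆ ⟦ ƛ (weaken v · s) · u ⟧
  σ₃-⊆ = ⟦⟧-⊆ λ where
    (app {Γ = Γv} Dv (app {Γ' = Γu} (lam (cons {Γ = Γ} Ds nil)) Du e₁) e₂) →
      ⊨-resp-≈ (redex-⊨ (⊢⇒⊨ (app (⊢-weaken Dv) Ds e₂)) (⊢⇒⊨ Du) e₁)
               (≈E.trans (≈E.assoc Γv Γ Γu) (≈E.∙-congˡ (≈E.∙-congʳ (≈E.sym (≈E.identityʳ Γ)))))
               ≈P.refl

  σ₃-⊇ : ⟦ ƛ (weaken v · s) · u ⟧ ⊆ ⟦ v · (ƛ s · u) ⟧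
  σ₃-⊇ = ⟦⟧-⊆ from-⊢
    where
    from-⊢ : ∀ {Γ Q} → Γ ⊢ ƛ (weaken v · s) · u ∶ Q → Γ ⊨ v · (ƛ s · u) ∶ Q
    from-⊢ (app {Γ' = Γu} (lam (cons Dws nil)) Du e₁) with app-weakenˡ⁻ Dws
    ... | Γv , _ ∷ Γ , _ , _ , refl , Dv , Ds , e =
      ⊨-resp-≈ (app-⊨ (⊢⇒⊨ Dv) (redex-⊨ (⊢⇒⊨ Ds) (⊢⇒⊨ Du) e₁) e)
               (≈E.trans (≈E.sym (≈E.assoc Γv Γ Γu)) (≈E.∙-congʳ (≈E.sym (≈E.identityʳ _))))
               ≈P.refl

ƛ-⊆ : ∀ {k} {t t′ : Tm (suc k)} → ⟦ t ⟧ ⊆ ⟦ t′ ⟧ → ⟦ ƛ t ⟧ ⊆ ⟦ ƛ t′ ⟧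
ƛ-⊆ {t = t} {t′} t⊆t′ = ⟦⟧-⊆ λ { (lam Ds) → premises Ds }
  where
  premises : ∀ {Γ Ns} → Γ ⊢λ t ∶ Ns → Γ ⊨ ƛ t′ ∶ Ns
  premises nil          = ⊢⇒⊨ (lam nil)
  premises (cons Dt Ds) = lam-cons-⊨ (t⊆t′ (⊢⇒⊨ Dt)) (premises Ds)

·ˡ-⊆ : ∀ {k} {t t′ s : Tm k} → ⟦ t ⟧ ⊆ ⟦ t′ ⟧ → ⟦ t · s ⟧ ⊆ ⟦ t′ · s ⟧
·ˡ-⊆ t⊆t′ = ⟦⟧-⊆ λ { (app Dt Ds e) → app-⊨ (t⊆t′ (⊢⇒⊨ Dt)) (⊢⇒⊨ Ds) e }

·ʳ-⊆ : ∀ {k} {t s s′ : Tm k} → ⟦ s ⟧ ⊆ ⟦ s′ ⟧ → ⟦ t · s ⟧ ⊆ ⟦ t · s′ ⟧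
·ʳ-⊆ s⊆s′ = ⟦⟧-⊆ λ { (app Dt Ds e) → app-⊨ (⊢⇒⊨ Dt) (s⊆s′ (⊢⇒⊨ Ds)) e }

↦-≐ : ∀ {k} {t u : Tm k} → t ↦ u → ⟦ t ⟧ ≐ ⟦ u ⟧
↦-≐ (βv V)  = βv-⊆ V , βv-⊇ V
↦-≐ σ₁      = σ₁-⊆ , σ₁-⊇
↦-≐ (σ₃ _)  = σ₃-⊆ , σ₃-⊇   -- σ₃ preserves the semantics even when v is not a value

→sh-≐ : ∀ {k} {t u : Tm k} → t →sh u → ⟦ t ⟧ ≐ ⟦ u ⟧
→sh-≐ (root r) = ↦-≐ r
→sh-≐ (ƛ-c p)  = map ƛ-⊆ ƛ-⊆ (→sh-≐ p)
→sh-≐ (·-l p)  = map ·ˡ-⊆ ·ˡ-⊆ (→sh-≐ p)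
→sh-≐ (·-r p)  = map ·ʳ-⊆ ·ʳ-⊆ (→sh-≐ p)

≐-isEquivalence : ∀ {A : Set} → IsEquivalence {A = Pred A 0ℓ} _≐_
≐-isEquivalence = record { refl = ≐-refl ; sym = ≐-sym ; trans = ≐-trans }

theorem4p2 : ∀ (k : ℕ) (t u : Tm k) → t ≃sh u → ⟦ t ⟧ ≐ ⟦ u ⟧
theorem4p2 k t u = EqClosure.gfold ≐-isEquivalence ⟦_⟧ →sh-≐
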